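{- For every integer $n\ge 1$, $$\widehat E_{2n}=(2n)!\sum_{t_1+2t_2+\cdots+nt_n=n}\binom{t_1+\cdots+t_n}{t_1,\dots,t_n}(-1)^{t_1+\cdots+t_n}\left(\frac{1}{3!}\right)^{t_1}\left(\frac{1}{5!}\right)^{t_2}\cdots\left(\frac{1}{(2n+1)!}\right)^{t_n},$$ the sum running over tuples of nonnegative integers $(t_1,\dots,t_n)$ with $t_1+2t_2+\cdots+nt_n=n$. Moreover, $$\frac{(-1)^n}{(2n+1)!}=\det \widehat M_n,$$ where $\widehat M_n$ is the $n\times n$ matrix with $(\widehat M_n)_{i,j}=\frac{\widehat E_{2(i-j+1)}}{(2(i-j+1))!}$ for $i\ge j$, $(\widehat M_n)_{i,i+1}=1$, and $(\widehat M_n)_{i,j}=0$ for $j>i+1$.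
   Context: $\widehat E_n$ are the complementary Euler numbers, defined by $\frac{t}{\sinh t}=\sum_{n\ge0}\widehat E_n\frac{t^n}{n!}$. $\binom{t_1+\cdots+t_n}{t_1,\dots,t_n}=\frac{(t_1+\cdots+t_n)!}{t_1!\cdots t_n!}$. -}

module Defs where

open import Data.Nat as ℕ using (ℕ; zero; suc; _!; _≤ᵇ_; _≡ᵇ_)
open import Data.Nat.Properties using (_!≢0)
open import Data.Integer using (+_)
open import Data.Rational using (ℚ; 0ℚ; 1ℚ; _+_; _*_; -_; _/_)
open import Data.Fin using (Fin; toℕ; punchIn)
import Data.Fin as Fin
open import Data.Vec using (Vec; []; _∷_)
import Data.Vec as Vec
open import Data.List using (List; []; _∷_; [_]; map; concatMap; upTo; allFin; filterᵇ; foldr)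
open import Relation.Binary.PropositionalEquality using (_≡_)
open import Data.Bool using (Bool; true; false; if_then_else_)

ℕtoℚ : ℕ → ℚ
ℕtoℚ n = (+ n) / 1

inv! : ℕ → ℚ
inv! k = ((+ 1) / (k !)) {{k !≢0}}

_^ℚ_ : ℚ → ℕ → ℚ
x ^ℚ zero = 1ℚ
x ^ℚ suc k = x * (x ^ℚ k)

sumℚ : List ℚ → ℚ
sumℚ = foldr _+_ 0ℚ

prodℚ : List ℚ → ℚ
prodℚ = foldr _*_ 1ℚ

isEven : ℕ → Bool
isEven zero = true
isEven (suc zero) = false
isEven (suc (suc m)) = isEven m

-- coefficient of t^m in  sinh t / t = Σ_k t^(2k) / (2k+1)!
sinhOverTCoeff : ℕ → ℚ
sinhOverTCoeff m = if isEven m then inv! (suc m) else 0ℚ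

-- E is the sequence of complementary Euler numbers:
--   t / sinh t = Σ_n E n t^n / n!,
-- stated as the identity of formal power series
--   (sinh t / t) * (Σ_n E n t^n / n!) = 1,
-- i.e. for every m the Cauchy-product coefficient of t^m is δ_{m,0}.
IsComplementaryEuler : (ℕ → ℚ) → Set
IsComplementaryEuler E =
  ∀ m → sumℚ (map (λ k → sinhOverTCoeff k * (E (m ℕ.∸ k) * inv! (m ℕ.∸ k))) (upTo (suc m)))
        ≡ (if m ≡ᵇ 0 then 1ℚ else 0ℚ)

allVecs : (k b : ℕ) → List (Vec ℕ k)
allVecs zero b = [ [] ]
allVecs (suc k) b = concatMap (λ x → map (x ∷_) (allVecs k b)) (upTo (suc b))

weightFrom : ∀ {k} → ℕ → Vec ℕ k → ℕ
weightFrom i [] = 0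
weightFrom i (t ∷ ts) = i ℕ.* t ℕ.+ weightFrom (suc i) ts

-- all tuples (t_1,…,t_n) of nonnegative integers with t_1 + 2 t_2 + ⋯ + n t_n = n
-- (each t_i ≤ n necessarily, so enumerating entries in {0,…,n} is exhaustive)
tuples : (n : ℕ) → List (Vec ℕ n)
tuples n = filterᵇ (λ t → weightFrom 1 t ≡ᵇ n) (allVecs n n)

multinomial : ∀ {k} → Vec ℕ k → ℚ
multinomial t = ℕtoℚ (Vec.sum t !) * prodℚ (Vec.toList (Vec.map inv! t))

powProdFrom : ∀ {k} → ℕ → Vec ℕ k → ℚ
powProdFrom i [] = 1ℚ
powProdFrom i (t ∷ ts) = (inv! (2 ℕ.* i ℕ.+ 1) ^ℚ t) * powProdFrom (suc i) ts

summand : ∀ {k} → Vec ℕ k → ℚ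
summand t = multinomial t * (((- 1ℚ) ^ℚ Vec.sum t) * powProdFrom 1 t)

det : ∀ {n} → (Fin n → Fin n → ℚ) → ℚ
det {zero} M = 1ℚ
det {suc n} M =
  sumℚ (map (λ j → ((- 1ℚ) ^ℚ toℕ j) * (M Fin.zero j * det (λ r c → M (Fin.suc r) (punchIn j c))))
            (allFin (suc n)))

-- the matrix \hat M_n (0-based indices; the entries depend only on i - j)
Mhat : (E : ℕ → ℚ) (n : ℕ) → Fin n → Fin n → ℚ
Mhat E n i j =
  if toℕ j ≤ᵇ toℕ i
  then (let d = 2 ℕ.* (toℕ i ℕ.∸ toℕ j ℕ.+ 1) in E d * inv! d)
  else (if toℕ j ≡ᵇ suc (toℕ i) then 1ℚ else 0ℚ)

{-# OPTIONS --safe #-}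
module Submission where

-- Put a k = Ê₂ₖ / (2k)! and b k = 1 / (2k+1)!. As sinh t / t is even, the definition of Ê says
-- that a and b are inverse power series in t², so a = 1 / (1 − β₁x − β₂x² − ⋯) with βᵢ = −bᵢ.
-- Expanding this geometric series by the multinomial theorem gives the first formula: both sides
-- obey a₀ = 1, a (w+1) = ∑ⱼ βⱼ₊₁ a (w−j), the multinomial side by Pascal's rule for multinomial
-- coefficients. Expanding the Hessenberg determinant along its first row, which is (a₁, 1, 0, …, 0),
-- and using the same convolution identity gives det M̂ₙ = (−1)ⁿ bₙ.

open import Defs
open import Data.Nat using (ℕ; _≤_; _!; _*_; suc)
open import Data.Rational using (ℚ; 1ℚ; -_) renaming (_*_ to _*ℚ_)
open import Data.List using (map)
open import Data.Product using (_×_)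
open import Relation.Binary.PropositionalEquality using (_≡_)

open import Data.Bool using (Bool; true; false; if_then_else_; T)
open import Data.Fin as Fin using (Fin; toℕ; punchIn)
import Data.Integer as ℤ
import Data.Integer.Properties as ℤ
open import Data.List using (List; []; _∷_; _++_; applyUpTo; upTo; concatMap; filterᵇ; allFin; tabulate)
import Data.List.Properties as List
open import Data.Nat as ℕ using (zero; _<_; _∸_; z≤n; s≤s; _≤ᵇ_; _≡ᵇ_; _≟_)
import Data.Nat.Induction as ℕ
import Data.Nat.Properties as ℕ
open import Data.Nat.Tactic.RingSolver using (solve-∀)
open import Data.Product using (_,_)
open import Data.Rational using (0ℚ; _+_; _-_; _/_)
import Data.Rational.Properties as ℚ
open import Algebra.Properties.Group ℚ.+-0-group using (inverseˡ-unique)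
open import Data.Rational.Solver using (module +-*-Solver)
import Data.Rational.Unnormalised as ℚᵘ
import Data.Rational.Unnormalised.Properties as ℚᵘ
open import Data.Unit using (tt)
open import Data.Vec as Vec using (Vec; []; _∷_)
open import Function using (_∘_; mk⇔)
open import Relation.Binary.PropositionalEquality using (_≢_; refl; sym; trans; cong; cong₂; subst; module ≡-Reasoning)
open import Relation.Nullary.Decidable using (dec-false; does-⇔)

open ≡-Reasoning
open +-*-Solver using (solve; _:=_; _:+_; _:-_; _:*_; :-_; con)

ℕtoℚ-suc : ∀ n → ℕtoℚ (suc n) ≡ 1ℚ + ℕtoℚ n
ℕtoℚ-suc n = ℚ.toℚᵘ-injective
  (ℚᵘ.≃-trans (ℚ.toℚᵘ-fromℚᵘ (ℚᵘ.mkℚᵘ (ℤ.+ suc n) 0))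
  (ℚᵘ.≃-trans (ℚᵘ.*≡* integral)
  (ℚᵘ.≃-sym (ℚᵘ.≃-trans (ℚ.toℚᵘ-homo-+ 1ℚ (ℕtoℚ n))
                        (ℚᵘ.+-congʳ ℚᵘ.1ℚᵘ (ℚ.toℚᵘ-fromℚᵘ (ℚᵘ.mkℚᵘ (ℤ.+ n) 0)))))))
  where
  integral : ℤ.+ suc n ℤ.* ℤ.+ 1 ≡ (ℤ.+ 1 ℤ.+ ℤ.+ n ℤ.* ℤ.+ 1) ℤ.* ℤ.+ 1
  integral = trans (ℤ.*-identityʳ (ℤ.+ suc n))
    (trans (cong (ℤ._+_ (ℤ.+ 1)) (sym (ℤ.*-identityʳ (ℤ.+ n)))) (sym (ℤ.*-identityʳ _)))

ℕtoℚ-*-inverse : ∀ d .{{_ : ℕ.NonZero d}} → ℕtoℚ d *ℚ ((ℤ.+ 1) / d) ≡ 1ℚ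
ℕtoℚ-*-inverse (suc k) = ℚ.toℚᵘ-injective
  (ℚᵘ.≃-trans (ℚ.toℚᵘ-homo-* (ℕtoℚ (suc k)) ((ℤ.+ 1) / suc k))
  (ℚᵘ.≃-trans (ℚᵘ.*-cong (ℚ.toℚᵘ-fromℚᵘ (ℚᵘ.mkℚᵘ (ℤ.+ suc k) 0)) (ℚ.toℚᵘ-fromℚᵘ (ℚᵘ.mkℚᵘ (ℤ.+ 1) k)))
              (ℚᵘ.*≡* integral)))
  where
  integral : (ℤ.+ suc k ℤ.* ℤ.+ 1) ℤ.* ℤ.+ 1 ≡ ℤ.+ 1 ℤ.* (ℤ.+ 1 ℤ.* ℤ.+ suc k)
  integral = trans (ℤ.*-identityʳ (ℤ.+ suc k ℤ.* ℤ.+ 1)) (trans (ℤ.*-identityʳ (ℤ.+ suc k))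
    (sym (trans (ℤ.*-identityˡ (ℤ.+ 1 ℤ.* ℤ.+ suc k)) (ℤ.*-identityˡ (ℤ.+ suc k)))))

ℕtoℚ-homo-+ : ∀ m n → ℕtoℚ (m ℕ.+ n) ≡ ℕtoℚ m + ℕtoℚ n
ℕtoℚ-homo-+ zero n = sym (ℚ.+-identityˡ (ℕtoℚ n))
ℕtoℚ-homo-+ (suc m) n = begin
  ℕtoℚ (suc (m ℕ.+ n))        ≡⟨ ℕtoℚ-suc (m ℕ.+ n) ⟩
  1ℚ + ℕtoℚ (m ℕ.+ n)         ≡⟨ cong (1ℚ +_) (ℕtoℚ-homo-+ m n) ⟩
  1ℚ + (ℕtoℚ m + ℕtoℚ n)      ≡⟨ sym (ℚ.+-assoc 1ℚ (ℕtoℚ m) (ℕtoℚ n)) ⟩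
  (1ℚ + ℕtoℚ m) + ℕtoℚ n      ≡⟨ cong (_+ ℕtoℚ n) (sym (ℕtoℚ-suc m)) ⟩
  ℕtoℚ (suc m) + ℕtoℚ n       ∎

ℕtoℚ-homo-* : ∀ m n → ℕtoℚ (m * n) ≡ ℕtoℚ m *ℚ ℕtoℚ n
ℕtoℚ-homo-* zero n = sym (ℚ.*-zeroˡ (ℕtoℚ n))
ℕtoℚ-homo-* (suc m) n = begin
  ℕtoℚ (n ℕ.+ m * n)                ≡⟨ ℕtoℚ-homo-+ n (m * n) ⟩
  ℕtoℚ n + ℕtoℚ (m * n)             ≡⟨ cong (ℕtoℚ n +_) (ℕtoℚ-homo-* m n) ⟩
  ℕtoℚ n + ℕtoℚ m *ℚ ℕtoℚ n         ≡⟨ solve 2 (λ x y → y :+ x :* y := (con 1ℚ :+ x) :* y) refl (ℕtoℚ m) (ℕtoℚ n) ⟩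
  (1ℚ + ℕtoℚ m) *ℚ ℕtoℚ n          ≡⟨ cong (_*ℚ ℕtoℚ n) (sym (ℕtoℚ-suc m)) ⟩
  ℕtoℚ (suc m) *ℚ ℕtoℚ n           ∎

!*inv!≡1 : ∀ k → ℕtoℚ (k !) *ℚ inv! k ≡ 1ℚ
!*inv!≡1 k = ℕtoℚ-*-inverse (k !) {{k ℕ.!≢0}}

inv!-suc : ∀ k → inv! k ≡ ℕtoℚ (suc k) *ℚ inv! (suc k)
inv!-suc k = begin
  inv! k                                           ≡⟨ sym (ℚ.*-identityʳ (inv! k)) ⟩
  inv! k *ℚ 1ℚ                                     ≡⟨ cong (inv! k *ℚ_) (sym (!*inv!≡1 (suc k))) ⟩
  inv! k *ℚ (ℕtoℚ (suc k * k !) *ℚ inv! (suc k))  ≡⟨ cong (λ x → inv! k *ℚ (x *ℚ inv! (suc k))) (ℕtoℚ-homo-* (suc k) (k !)) ⟩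
  inv! k *ℚ ((c *ℚ f) *ℚ inv! (suc k))             ≡⟨ solve 4 (λ i c f j → i :* ((c :* f) :* j) := (f :* i) :* (c :* j)) refl (inv! k) c f (inv! (suc k)) ⟩
  (f *ℚ inv! k) *ℚ (c *ℚ inv! (suc k))             ≡⟨ cong (_*ℚ (c *ℚ inv! (suc k))) (!*inv!≡1 k) ⟩
  1ℚ *ℚ (c *ℚ inv! (suc k))                        ≡⟨ ℚ.*-identityˡ _ ⟩
  c *ℚ inv! (suc k)                                ∎
  where
  c = ℕtoℚ (suc k)
  f = ℕtoℚ (k !)

^ℚ-homo-+ : ∀ x m n → x ^ℚ (m ℕ.+ n) ≡ (x ^ℚ m) *ℚ (x ^ℚ n)
^ℚ-homo-+ x zero n = sym (ℚ.*-identityˡ _)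
^ℚ-homo-+ x (suc m) n = trans (cong (x *ℚ_) (^ℚ-homo-+ x m n)) (sym (ℚ.*-assoc x _ _))

^ℚ-distrib-* : ∀ x y n → (x *ℚ y) ^ℚ n ≡ (x ^ℚ n) *ℚ (y ^ℚ n)
^ℚ-distrib-* x y zero = refl
^ℚ-distrib-* x y (suc n) = trans (cong ((x *ℚ y) *ℚ_) (^ℚ-distrib-* x y n))
  (solve 4 (λ x y a b → (x :* y) :* (a :* b) := (x :* a) :* (y :* b)) refl x y (x ^ℚ n) (y ^ℚ n))

∑ : ℕ → (ℕ → ℚ) → ℚ
∑ zero    f = 0ℚ
∑ (suc n) f = f 0 + ∑ n (f ∘ suc)

syntax ∑ n (λ k → e) = ∑[ k < n ] e

∑-cong< : ∀ n {f g : ℕ → ℚ} → (∀ k → k < n → f k ≡ g k) → ∑ n f ≡ ∑ n g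
∑-cong< zero    eq = refl
∑-cong< (suc n) eq = cong₂ _+_ (eq 0 (s≤s z≤n)) (∑-cong< n (λ k k<n → eq (suc k) (s≤s k<n)))

∑-cong : ∀ n {f g : ℕ → ℚ} → (∀ k → f k ≡ g k) → ∑ n f ≡ ∑ n g
∑-cong n eq = ∑-cong< n (λ k _ → eq k)

∑-zero : ∀ n {f : ℕ → ℚ} → (∀ k → f k ≡ 0ℚ) → ∑ n f ≡ 0ℚ
∑-zero zero    eq = refl
∑-zero (suc n) eq = trans (cong₂ _+_ (eq 0) (∑-zero n (eq ∘ suc))) (ℚ.+-identityˡ 0ℚ)

*-distribˡ-∑ : ∀ n c (f : ℕ → ℚ) → c *ℚ ∑ n f ≡ ∑[ k < n ] (c *ℚ f k)
*-distribˡ-∑ zero    c f = ℚ.*-zeroʳ c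
*-distribˡ-∑ (suc n) c f = trans (ℚ.*-distribˡ-+ c (f 0) _) (cong (c *ℚ f 0 +_) (*-distribˡ-∑ n c (f ∘ suc)))

*-distribʳ-∑ : ∀ n c (f : ℕ → ℚ) → ∑ n f *ℚ c ≡ ∑[ k < n ] (f k *ℚ c)
*-distribʳ-∑ n c f = trans (ℚ.*-comm (∑ n f) c)
  (trans (*-distribˡ-∑ n c f) (∑-cong n (λ k → ℚ.*-comm c (f k))))

∑-neg : ∀ n (f : ℕ → ℚ) → ∑[ k < n ] (- f k) ≡ - ∑ n f
∑-neg zero    f = refl
∑-neg (suc n) f = trans (cong (- f 0 +_) (∑-neg n (f ∘ suc))) (sym (ℚ.neg-distrib-+ (f 0) _))

∑-+ : ∀ m n (f : ℕ → ℚ) → ∑ (m ℕ.+ n) f ≡ ∑ m f + ∑[ k < n ] f (m ℕ.+ k)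
∑-+ zero    n f = sym (ℚ.+-identityˡ _)
∑-+ (suc m) n f = trans (cong (f 0 +_) (∑-+ m n (f ∘ suc))) (sym (ℚ.+-assoc (f 0) _ _))

∑-suc : ∀ n (f : ℕ → ℚ) → ∑ (suc n) f ≡ ∑ n f + f n
∑-suc zero    f = ℚ.+-comm (f 0) 0ℚ
∑-suc (suc n) f = trans (cong (f 0 +_) (∑-suc n (f ∘ suc))) (sym (ℚ.+-assoc (f 0) _ _))

∑-even : ∀ N (f : ℕ → ℚ) → (∀ j → f (suc (2 * j)) ≡ 0ℚ) → ∑ (suc (2 * N)) f ≡ ∑[ j < suc N ] f (2 * j)
∑-even zero    f odd = refl
∑-even (suc N) f odd = begin
  ∑ (suc (2 * suc N)) f
    ≡⟨ cong (λ m → ∑ (suc m) f) (ℕ.*-suc 2 N) ⟩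
  f 0 + (f 1 + ∑ (suc (2 * N)) (f ∘ suc ∘ suc))
    ≡⟨ cong (λ x → f 0 + (x + ∑ (suc (2 * N)) (f ∘ suc ∘ suc))) (odd 0) ⟩
  f 0 + (0ℚ + ∑ (suc (2 * N)) (f ∘ suc ∘ suc))
    ≡⟨ cong (f 0 +_) (ℚ.+-identityˡ _) ⟩
  f 0 + ∑ (suc (2 * N)) (f ∘ suc ∘ suc)
    ≡⟨ cong (f 0 +_) (∑-even N (f ∘ suc ∘ suc) (λ j → trans (cong (f ∘ suc) (sym (ℕ.*-suc 2 j))) (odd (suc j)))) ⟩
  f 0 + ∑[ j < suc N ] f (suc (suc (2 * j)))
    ≡⟨ cong (f 0 +_) (∑-cong (suc N) (λ j → cong f (sym (ℕ.*-suc 2 j)))) ⟩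
  ∑[ j < suc (suc N) ] f (2 * j) ∎

∑∈ : {A : Set} → List A → (A → ℚ) → ℚ
∑∈ xs f = sumℚ (map f xs)

syntax ∑∈ xs (λ x → e) = ∑[ x ∈ xs ] e

∑∈-cong : {A : Set} (xs : List A) {f g : A → ℚ} → (∀ x → f x ≡ g x) → ∑∈ xs f ≡ ∑∈ xs g
∑∈-cong xs eq = cong sumℚ (List.map-cong eq xs)

∑∈-zero : {A : Set} (xs : List A) {f : A → ℚ} → (∀ x → f x ≡ 0ℚ) → ∑∈ xs f ≡ 0ℚ
∑∈-zero []       eq = refl
∑∈-zero (x ∷ xs) eq = trans (cong₂ _+_ (eq x) (∑∈-zero xs eq)) (ℚ.+-identityˡ 0ℚ)

∑∈-++ : {A : Set} (xs ys : List A) (f : A → ℚ) → ∑∈ (xs ++ ys) f ≡ ∑∈ xs f + ∑∈ ys f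
∑∈-++ []       ys f = sym (ℚ.+-identityˡ _)
∑∈-++ (x ∷ xs) ys f = trans (cong (f x +_) (∑∈-++ xs ys f)) (sym (ℚ.+-assoc (f x) _ _))

∑∈-concatMap : {A B : Set} (g : A → List B) (xs : List A) (f : B → ℚ) →
  ∑∈ (concatMap g xs) f ≡ ∑[ x ∈ xs ] ∑∈ (g x) f
∑∈-concatMap g []       f = refl
∑∈-concatMap g (x ∷ xs) f = trans (∑∈-++ (g x) (concatMap g xs) f) (cong (∑∈ (g x) f +_) (∑∈-concatMap g xs f))

∑∈-map : {A B : Set} (g : A → B) (xs : List A) (f : B → ℚ) → ∑∈ (map g xs) f ≡ ∑∈ xs (f ∘ g)
∑∈-map g xs f = cong sumℚ (sym (List.map-∘ xs))

∑∈-applyUpTo : ∀ n (g : ℕ → ℕ) (f : ℕ → ℚ) → ∑∈ (applyUpTo g n) f ≡ ∑ n (f ∘ g)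
∑∈-applyUpTo zero    g f = refl
∑∈-applyUpTo (suc n) g f = cong (f (g 0) +_) (∑∈-applyUpTo n (g ∘ suc) f)

∑∈-filterᵇ : {A : Set} (p : A → Bool) (xs : List A) (f : A → ℚ) →
  ∑∈ (filterᵇ p xs) f ≡ ∑[ x ∈ xs ] (if p x then f x else 0ℚ)
∑∈-filterᵇ p []       f = refl
∑∈-filterᵇ p (x ∷ xs) f with p x
... | true  = cong (f x +_) (∑∈-filterᵇ p xs f)
... | false = trans (∑∈-filterᵇ p xs f) (sym (ℚ.+-identityˡ _))

*-distribˡ-∑∈ : {A : Set} (xs : List A) (c : ℚ) (f : A → ℚ) → c *ℚ ∑∈ xs f ≡ ∑[ x ∈ xs ] (c *ℚ f x)
*-distribˡ-∑∈ []       c f = ℚ.*-zeroʳ c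
*-distribˡ-∑∈ (x ∷ xs) c f = trans (ℚ.*-distribˡ-+ c (f x) _) (cong (c *ℚ f x +_) (*-distribˡ-∑∈ xs c f))

∑∈-distrib-+ : {A : Set} (xs : List A) (f g : A → ℚ) → ∑[ x ∈ xs ] (f x + g x) ≡ ∑∈ xs f + ∑∈ xs g
∑∈-distrib-+ []       f g = sym (ℚ.+-identityˡ 0ℚ)
∑∈-distrib-+ (x ∷ xs) f g = trans (cong (f x + g x +_) (∑∈-distrib-+ xs f g))
  (solve 4 (λ a b c d → (a :+ b) :+ (c :+ d) := (a :+ c) :+ (b :+ d)) refl (f x) (g x) _ _)

∑∈-∑-comm : {A : Set} (xs : List A) (n : ℕ) (f : A → ℕ → ℚ) →
  ∑[ x ∈ xs ] ∑ n (f x) ≡ ∑[ k < n ] ∑[ x ∈ xs ] f x k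
∑∈-∑-comm xs zero    f = ∑∈-zero xs (λ _ → refl)
∑∈-∑-comm xs (suc n) f = trans (∑∈-distrib-+ xs _ _) (cong (∑[ x ∈ xs ] f x 0 +_) (∑∈-∑-comm xs n (λ x → f x ∘ suc)))

∑-allVecs-suc : ∀ k B (f : Vec ℕ (suc k) → ℚ) →
  ∑∈ (allVecs (suc k) B) f ≡ ∑[ x < suc B ] ∑[ ts ∈ allVecs k B ] f (x ∷ ts)
∑-allVecs-suc k B f = begin
  ∑∈ (concatMap (λ x → map (x ∷_) (allVecs k B)) (upTo (suc B))) f
    ≡⟨ ∑∈-concatMap (λ x → map (x ∷_) (allVecs k B)) (upTo (suc B)) f ⟩
  ∑[ x ∈ upTo (suc B) ] ∑∈ (map (x ∷_) (allVecs k B)) f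
    ≡⟨ ∑∈-cong (upTo (suc B)) (λ x → ∑∈-map (x ∷_) (allVecs k B) f) ⟩
  ∑[ x ∈ upTo (suc B) ] ∑[ ts ∈ allVecs k B ] f (x ∷ ts)
    ≡⟨ ∑∈-applyUpTo (suc B) (λ x → x) (λ x → ∑[ ts ∈ allVecs k B ] f (x ∷ ts)) ⟩
  ∑[ x < suc B ] ∑[ ts ∈ allVecs k B ] f (x ∷ ts) ∎

-- Out-of-range positions read as 0; decrementAt is only applied where the entry is positive.
entry : ∀ {k} → ℕ → Vec ℕ k → ℕ
entry j       []       = 0
entry zero    (x ∷ ts) = x
entry (suc j) (x ∷ ts) = entry j ts

decrementAt : ∀ {k} → ℕ → Vec ℕ k → Vec ℕ k
decrementAt j       []       = []
decrementAt zero    (x ∷ ts) = ℕ.pred x ∷ ts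
decrementAt (suc j) (x ∷ ts) = x ∷ decrementAt j ts

when : Bool → ℚ → ℚ
when c q = if c then q else 0ℚ

when-*ʳ : ∀ c x y → when c (x *ℚ y) ≡ x *ℚ when c y
when-*ʳ true  x y = refl
when-*ʳ false x y = sym (ℚ.*-zeroʳ x)

when-zero : ∀ c → when c 0ℚ ≡ 0ℚ
when-zero true  = refl
when-zero false = refl

-- Decrementing the j-th multiplicity maps {t : tⱼ ≥ 1} bijectively onto {t : tⱼ < B}.
∑-allVecs-decrementAt : ∀ {k} B j → j < k → (f : Vec ℕ k → ℚ) → (∀ t → entry j t ≡ B → f t ≡ 0ℚ) →
  ∑[ t ∈ allVecs k B ] when (1 ≤ᵇ entry j t) (f (decrementAt j t)) ≡ ∑∈ (allVecs k B) f
∑-allVecs-decrementAt {suc k} B zero _ f top = begin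
  ∑∈ (allVecs (suc k) B) (λ t → when (1 ≤ᵇ entry 0 t) (f (decrementAt 0 t)))
    ≡⟨ ∑-allVecs-suc k B _ ⟩
  ∑[ ts ∈ allVecs k B ] 0ℚ + ∑ B F
    ≡⟨ cong (_+ ∑ B F) (∑∈-zero (allVecs k B) (λ _ → refl)) ⟩
  0ℚ + ∑ B F
    ≡⟨ ℚ.+-comm 0ℚ (∑ B F) ⟩
  ∑ B F + 0ℚ
    ≡⟨ cong (∑ B F +_) (sym (∑∈-zero (allVecs k B) (λ ts → top (B ∷ ts) refl))) ⟩
  ∑ B F + F B
    ≡⟨ sym (∑-suc B F) ⟩
  ∑ (suc B) F
    ≡⟨ sym (∑-allVecs-suc k B f) ⟩
  ∑∈ (allVecs (suc k) B) f ∎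
  where
  F : ℕ → ℚ
  F x = ∑[ ts ∈ allVecs k B ] f (x ∷ ts)
∑-allVecs-decrementAt {suc k} B (suc j) (s≤s j<k) f top = begin
  ∑∈ (allVecs (suc k) B) (λ t → when (1 ≤ᵇ entry (suc j) t) (f (decrementAt (suc j) t)))
    ≡⟨ ∑-allVecs-suc k B _ ⟩
  ∑[ x < suc B ] ∑[ ts ∈ allVecs k B ] when (1 ≤ᵇ entry j ts) (f (x ∷ decrementAt j ts))
    ≡⟨ ∑-cong (suc B) (λ x → ∑-allVecs-decrementAt B j j<k (f ∘ (x ∷_)) (λ ts → top (x ∷ ts))) ⟩
  ∑[ x < suc B ] ∑[ ts ∈ allVecs k B ] f (x ∷ ts)
    ≡⟨ sym (∑-allVecs-suc k B f) ⟩
  ∑∈ (allVecs (suc k) B) f ∎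

sum-decrementAt : ∀ {k} j (t : Vec ℕ k) {y} → entry j t ≡ suc y → Vec.sum t ≡ suc (Vec.sum (decrementAt j t))
sum-decrementAt zero    (x ∷ ts) refl = refl
sum-decrementAt (suc j) (x ∷ ts) eq   = trans (cong (x ℕ.+_) (sum-decrementAt j ts eq)) (ℕ.+-suc x _)

weightFrom-decrementAt : ∀ {k} i j (t : Vec ℕ k) {y} → entry j t ≡ suc y →
  weightFrom i t ≡ weightFrom i (decrementAt j t) ℕ.+ (i ℕ.+ j)
weightFrom-decrementAt i zero (x ∷ ts) {y} refl = shuffle i y (weightFrom (suc i) ts)
  where
  shuffle : ∀ i y w → i * suc y ℕ.+ w ≡ i * y ℕ.+ w ℕ.+ (i ℕ.+ 0)
  shuffle = solve-∀
weightFrom-decrementAt i (suc j) (x ∷ ts) eq = begin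
  i * x ℕ.+ weightFrom (suc i) ts
    ≡⟨ cong (i * x ℕ.+_) (weightFrom-decrementAt (suc i) j ts eq) ⟩
  i * x ℕ.+ (weightFrom (suc i) (decrementAt j ts) ℕ.+ suc (i ℕ.+ j))
    ≡⟨ sym (ℕ.+-assoc (i * x) _ _) ⟩
  i * x ℕ.+ weightFrom (suc i) (decrementAt j ts) ℕ.+ suc (i ℕ.+ j)
    ≡⟨ cong (i * x ℕ.+ weightFrom (suc i) (decrementAt j ts) ℕ.+_) (sym (ℕ.+-suc i j)) ⟩
  i * x ℕ.+ weightFrom (suc i) (decrementAt j ts) ℕ.+ (i ℕ.+ suc j) ∎

entry-weightFrom-≤ : ∀ {k} i j (t : Vec ℕ k) → (i ℕ.+ j) * entry j t ≤ weightFrom i t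
entry-weightFrom-≤ i j [] rewrite ℕ.*-zeroʳ (i ℕ.+ j) = z≤n
entry-weightFrom-≤ i zero (x ∷ ts) rewrite ℕ.+-identityʳ i = ℕ.m≤m+n (i * x) _
entry-weightFrom-≤ i (suc j) (x ∷ ts) rewrite ℕ.+-suc i j =
  ℕ.≤-trans (entry-weightFrom-≤ (suc i) j ts) (ℕ.m≤n+m _ (i * x))

∑-entry : ∀ {k} (t : Vec ℕ k) → ∑[ j < k ] ℕtoℚ (entry j t) ≡ ℕtoℚ (Vec.sum t)
∑-entry []       = refl
∑-entry (x ∷ ts) = trans (cong (ℕtoℚ x +_) (∑-entry ts)) (sym (ℕtoℚ-homo-+ x (Vec.sum ts)))

weightFrom-sum≡0 : ∀ {k} i (t : Vec ℕ k) → Vec.sum t ≡ 0 → weightFrom i t ≡ 0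
weightFrom-sum≡0 i []            _  = refl
weightFrom-sum≡0 i (zero ∷ ts)   eq rewrite ℕ.*-zeroʳ i = weightFrom-sum≡0 (suc i) ts eq

∑-allVecs-weightFrom≡0 : ∀ k i B (f : Vec ℕ k → ℚ) →
  ∑[ t ∈ allVecs k B ] when (weightFrom (suc i) t ≡ᵇ 0) (f t) ≡ f (Vec.replicate k 0)
∑-allVecs-weightFrom≡0 zero    i B f = ℚ.+-identityʳ (f [])
∑-allVecs-weightFrom≡0 (suc k) i B f = begin
  ∑[ t ∈ allVecs (suc k) B ] when (weightFrom (suc i) t ≡ᵇ 0) (f t)
    ≡⟨ ∑-allVecs-suc k B _ ⟩
  ∑[ ts ∈ allVecs k B ] when (suc i * 0 ℕ.+ w ts ≡ᵇ 0) (f (0 ∷ ts))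
    + ∑[ x < B ] ∑[ ts ∈ allVecs k B ] when (suc i * suc x ℕ.+ w ts ≡ᵇ 0) (f (suc x ∷ ts))
    ≡⟨ cong₂ _+_ (∑∈-cong (allVecs k B) (λ ts → cong (λ n → when (n ℕ.+ w ts ≡ᵇ 0) (f (0 ∷ ts))) (ℕ.*-zeroʳ (suc i))))
                 (∑-zero B (λ x → ∑∈-zero (allVecs k B) (λ ts → refl))) ⟩
  ∑[ ts ∈ allVecs k B ] when (w ts ≡ᵇ 0) (f (0 ∷ ts)) + 0ℚ
    ≡⟨ ℚ.+-identityʳ _ ⟩
  ∑[ ts ∈ allVecs k B ] when (w ts ≡ᵇ 0) (f (0 ∷ ts))
    ≡⟨ ∑-allVecs-weightFrom≡0 k (suc i) B (f ∘ (0 ∷_)) ⟩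
  f (Vec.replicate (suc k) 0) ∎
  where
  w : Vec ℕ k → ℕ
  w = weightFrom (suc (suc i))

weight : ∀ {k} → Vec ℕ k → ℕ
weight = weightFrom 1

≡ᵇ-false : ∀ {m n} → n < m → (m ≡ᵇ n) ≡ false
≡ᵇ-false {m} {n} n<m = dec-false (m ≟ n) (λ m≡n → ℕ.<-irrefl (sym m≡n) n<m)

+-≡ᵇ-∸ : ∀ x {s v} → s ≤ v → (x ℕ.+ s ≡ᵇ v) ≡ (x ≡ᵇ v ∸ s)
+-≡ᵇ-∸ x {s} {v} s≤v = does-⇔ (mk⇔ to from) (x ℕ.+ s ≟ v) (x ≟ v ∸ s)
  where
  to : x ℕ.+ s ≡ v → x ≡ v ∸ s
  to eq = trans (sym (ℕ.m+n∸n≡m x s)) (cong (_∸ s) eq)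
  from : x ≡ v ∸ s → x ℕ.+ s ≡ v
  from eq = trans (cong (ℕ._+ s) eq) (ℕ.m∸n+n≡m s≤v)

-- The multinomial expansion of 1 / (1 - β₁ x - β₂ x² - ⋯)

-- termSum L B w is the coefficient of x^w in ∑ₘ (β₁ x + β₂ x² + ⋯)ᵐ, expanded by the
-- multinomial theorem over multiplicity vectors t ∈ {0,…,B}^L; the truncation to L and B
-- does not affect the coefficient as long as w ≤ L and w ≤ B.
module MultinomialExpansion (β : ℕ → ℚ) where

  monomialFrom : ∀ {k} → ℕ → Vec ℕ k → ℚ
  monomialFrom i []       = 1ℚ
  monomialFrom i (x ∷ ts) = ((β i ^ℚ x) *ℚ inv! x) *ℚ monomialFrom (suc i) ts

  term : ∀ {k} → Vec ℕ k → ℚ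
  term t = ℕtoℚ (Vec.sum t !) *ℚ monomialFrom 1 t

  termSum : (L B w : ℕ) → ℚ
  termSum L B w = ∑[ t ∈ allVecs L B ] when (weight t ≡ᵇ w) (term t)

  monomialFrom-decrementAt : ∀ {k} i j (t : Vec ℕ k) {y} → entry j t ≡ suc y →
    β (i ℕ.+ j) *ℚ monomialFrom i (decrementAt j t) ≡ ℕtoℚ (suc y) *ℚ monomialFrom i t
  monomialFrom-decrementAt i zero (x ∷ ts) {y} refl = begin
    β (i ℕ.+ 0) *ℚ ((b ^ℚ y *ℚ inv! y) *ℚ rest)
      ≡⟨ cong (λ n → β n *ℚ ((b ^ℚ y *ℚ inv! y) *ℚ rest)) (ℕ.+-identityʳ i) ⟩
    b *ℚ ((b ^ℚ y *ℚ inv! y) *ℚ rest)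
      ≡⟨ cong (λ z → b *ℚ ((b ^ℚ y *ℚ z) *ℚ rest)) (inv!-suc y) ⟩
    b *ℚ ((b ^ℚ y *ℚ (ℕtoℚ (suc y) *ℚ inv! (suc y))) *ℚ rest)
      ≡⟨ solve 5 (λ b p c i r → b :* ((p :* (c :* i)) :* r) := c :* (((b :* p) :* i) :* r))
               refl b (b ^ℚ y) (ℕtoℚ (suc y)) (inv! (suc y)) rest ⟩
    ℕtoℚ (suc y) *ℚ (((b *ℚ b ^ℚ y) *ℚ inv! (suc y)) *ℚ rest) ∎
    where
    b = β i
    rest = monomialFrom (suc i) ts
  monomialFrom-decrementAt i (suc j) (x ∷ ts) {y} eq = begin
    β (i ℕ.+ suc j) *ℚ (c *ℚ monomialFrom (suc i) (decrementAt j ts))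
      ≡⟨ cong (λ n → β n *ℚ (c *ℚ monomialFrom (suc i) (decrementAt j ts))) (ℕ.+-suc i j) ⟩
    β (suc i ℕ.+ j) *ℚ (c *ℚ monomialFrom (suc i) (decrementAt j ts))
      ≡⟨ solve 3 (λ a c p → a :* (c :* p) := c :* (a :* p)) refl (β (suc i ℕ.+ j)) c _ ⟩
    c *ℚ (β (suc i ℕ.+ j) *ℚ monomialFrom (suc i) (decrementAt j ts))
      ≡⟨ cong (c *ℚ_) (monomialFrom-decrementAt (suc i) j ts eq) ⟩
    c *ℚ (ℕtoℚ (suc y) *ℚ monomialFrom (suc i) ts)
      ≡⟨ solve 3 (λ a c p → c :* (a :* p) := a :* (c :* p)) refl (ℕtoℚ (suc y)) c _ ⟩
    ℕtoℚ (suc y) *ℚ (c *ℚ monomialFrom (suc i) ts) ∎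
    where
    c = (β i ^ℚ x) *ℚ inv! x

  removePart : ∀ {k} → ℕ → Vec ℕ k → ℚ
  removePart j t = when (1 ≤ᵇ entry j t) (β (suc j) *ℚ term (decrementAt j t))

  removePart-entry : ∀ {k} j (t : Vec ℕ k) m → Vec.sum t ≡ suc m →
    removePart j t ≡ ℕtoℚ (m !) *ℚ (ℕtoℚ (entry j t) *ℚ monomialFrom 1 t)
  removePart-entry j t m sum≡ with entry j t in eq
  ... | zero  = sym (trans (cong (ℕtoℚ (m !) *ℚ_) (ℚ.*-zeroˡ (monomialFrom 1 t))) (ℚ.*-zeroʳ (ℕtoℚ (m !))))
  ... | suc y = begin
    β (suc j) *ℚ (ℕtoℚ (Vec.sum (decrementAt j t) !) *ℚ monomialFrom 1 (decrementAt j t))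
      ≡⟨ cong (λ n → β (suc j) *ℚ (ℕtoℚ (n !) *ℚ monomialFrom 1 (decrementAt j t))) sum-dec≡ ⟩
    β (suc j) *ℚ (ℕtoℚ (m !) *ℚ monomialFrom 1 (decrementAt j t))
      ≡⟨ solve 3 (λ a c p → a :* (c :* p) := c :* (a :* p)) refl (β (suc j)) (ℕtoℚ (m !)) _ ⟩
    ℕtoℚ (m !) *ℚ (β (1 ℕ.+ j) *ℚ monomialFrom 1 (decrementAt j t))
      ≡⟨ cong (ℕtoℚ (m !) *ℚ_) (monomialFrom-decrementAt 1 j t eq) ⟩
    ℕtoℚ (m !) *ℚ (ℕtoℚ (suc y) *ℚ monomialFrom 1 t) ∎
    where
    sum-dec≡ : Vec.sum (decrementAt j t) ≡ m
    sum-dec≡ = ℕ.suc-injective (trans (sym (sum-decrementAt j t eq)) sum≡)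

  term-pascal : ∀ {k} (t : Vec ℕ k) m → Vec.sum t ≡ suc m → term t ≡ ∑[ j < k ] removePart j t
  term-pascal {k} t m sum≡ = begin
    ℕtoℚ (Vec.sum t !) *ℚ p
      ≡⟨ cong (λ n → ℕtoℚ (n !) *ℚ p) sum≡ ⟩
    ℕtoℚ (suc m * m !) *ℚ p
      ≡⟨ cong (_*ℚ p) (ℕtoℚ-homo-* (suc m) (m !)) ⟩
    (ℕtoℚ (suc m) *ℚ c) *ℚ p
      ≡⟨ solve 3 (λ a c p → (a :* c) :* p := c :* (a :* p)) refl (ℕtoℚ (suc m)) c p ⟩
    c *ℚ (ℕtoℚ (suc m) *ℚ p)
      ≡⟨ cong (λ n → c *ℚ (n *ℚ p)) (sym (trans (∑-entry t) (cong ℕtoℚ sum≡))) ⟩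
    c *ℚ (∑[ j < k ] ℕtoℚ (entry j t) *ℚ p)
      ≡⟨ cong (c *ℚ_) (*-distribʳ-∑ k p _) ⟩
    c *ℚ ∑[ j < k ] (ℕtoℚ (entry j t) *ℚ p)
      ≡⟨ *-distribˡ-∑ k c _ ⟩
    ∑[ j < k ] (c *ℚ (ℕtoℚ (entry j t) *ℚ p))
      ≡⟨ sym (∑-cong k (λ j → removePart-entry j t m sum≡)) ⟩
    ∑[ j < k ] removePart j t ∎
    where
    c = ℕtoℚ (m !)
    p = monomialFrom 1 t

  when-weight-term : ∀ {k} w (t : Vec ℕ k) →
    when (weight t ≡ᵇ suc w) (term t) ≡ ∑[ j < k ] when (weight t ≡ᵇ suc w) (removePart j t)
  when-weight-term {k} w t with weight t ≡ᵇ suc w in heavy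
  ... | false = sym (∑-zero k (λ _ → refl))
  ... | true  = term-pascal t (ℕ.pred (Vec.sum t)) (sym (ℕ.suc-pred (Vec.sum t) {{ℕ.≢-nonZero sum≢0}}))
    where
    sum≢0 : Vec.sum t ≢ 0
    sum≢0 sum≡0 = ℕ.0≢1+n (trans (sym (weightFrom-sum≡0 1 t sum≡0))
                                 (ℕ.≡ᵇ⇒≡ (weight t) (suc w) (subst T (sym heavy) tt)))

  when-weight-removePart : ∀ {k} j v (t : Vec ℕ k) →
    when (weight t ≡ᵇ v) (removePart j t)
      ≡ β (suc j) *ℚ when (1 ≤ᵇ entry j t)
                          (when (weight (decrementAt j t) ℕ.+ suc j ≡ᵇ v) (term (decrementAt j t)))
  when-weight-removePart j v t with entry j t in eq
  ... | zero  = trans (when-zero (weight t ≡ᵇ v)) (sym (ℚ.*-zeroʳ (β (suc j))))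
  ... | suc y = trans (cong (λ n → when (n ≡ᵇ v) (β (suc j) *ℚ term (decrementAt j t)))
                            (weightFrom-decrementAt 1 j t eq))
                      (when-*ʳ _ (β (suc j)) _)

  ∑-removePart : ∀ L B w j → j < L → j ≤ w → suc w ≤ B →
    ∑[ t ∈ allVecs L B ] when (weight t ≡ᵇ suc w) (removePart j t) ≡ β (suc j) *ℚ termSum L B (w ∸ j)
  ∑-removePart L B w j j<L j≤w w<B = begin
    ∑[ t ∈ allVecs L B ] when (weight t ≡ᵇ suc w) (removePart j t)
      ≡⟨ ∑∈-cong (allVecs L B) (when-weight-removePart j (suc w)) ⟩
    ∑[ t ∈ allVecs L B ] (β (suc j) *ℚ when (1 ≤ᵇ entry j t) (f (decrementAt j t)))
      ≡⟨ sym (*-distribˡ-∑∈ (allVecs L B) (β (suc j)) _) ⟩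
    β (suc j) *ℚ ∑[ t ∈ allVecs L B ] when (1 ≤ᵇ entry j t) (f (decrementAt j t))
      ≡⟨ cong (β (suc j) *ℚ_) (∑-allVecs-decrementAt B j j<L f f-top) ⟩
    β (suc j) *ℚ ∑∈ (allVecs L B) f
      ≡⟨ cong (β (suc j) *ℚ_) (∑∈-cong (allVecs L B) (λ t → cong (λ c → when c (term t)) (+-≡ᵇ-∸ (weight t) (s≤s j≤w)))) ⟩
    β (suc j) *ℚ termSum L B (w ∸ j) ∎
    where
    f : Vec ℕ L → ℚ
    f t = when (weight t ℕ.+ suc j ≡ᵇ suc w) (term t)
    f-top : ∀ t → entry j t ≡ B → f t ≡ 0ℚ
    f-top t eq = cong (λ c → when c (term t)) (≡ᵇ-false (ℕ.≤-<-trans heavy (ℕ.m<m+n (weight t) (s≤s z≤n))))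
      where
      heavy : suc w ≤ weight t
      heavy = ℕ.≤-trans w<B (ℕ.≤-trans (ℕ.m≤n*m B (suc j))
                (subst (λ e → suc j * e ≤ weight t) eq (entry-weightFrom-≤ 1 j t)))

  ∑-removePart-vanish : ∀ L B w j → w < j →
    ∑[ t ∈ allVecs L B ] when (weight t ≡ᵇ suc w) (removePart j t) ≡ 0ℚ
  ∑-removePart-vanish L B w j w<j = ∑∈-zero (allVecs L B) (λ t → begin
    when (weight t ≡ᵇ suc w) (removePart j t)
      ≡⟨ when-weight-removePart j (suc w) t ⟩
    β (suc j) *ℚ when (1 ≤ᵇ entry j t) (when (weight (decrementAt j t) ℕ.+ suc j ≡ᵇ suc w) (term (decrementAt j t)))
      ≡⟨ cong (λ c → β (suc j) *ℚ when (1 ≤ᵇ entry j t) (when c (term (decrementAt j t))))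
              (≡ᵇ-false (ℕ.<-≤-trans (s≤s w<j) (ℕ.m≤n+m (suc j) (weight (decrementAt j t))))) ⟩
    β (suc j) *ℚ when (1 ≤ᵇ entry j t) 0ℚ
      ≡⟨ cong (β (suc j) *ℚ_) (when-zero (1 ≤ᵇ entry j t)) ⟩
    β (suc j) *ℚ 0ℚ
      ≡⟨ ℚ.*-zeroʳ (β (suc j)) ⟩
    0ℚ ∎)

  termSum-zero : ∀ L B → termSum L B 0 ≡ 1ℚ
  termSum-zero L B = trans (∑-allVecs-weightFrom≡0 L 0 B term)
    (trans (cong (λ n → ℕtoℚ (n !) *ℚ monomialFrom 1 (Vec.replicate L 0)) (sum-replicate L))
    (trans (ℚ.*-identityˡ _) (monomialFrom-replicate L 1)))
    where
    sum-replicate : ∀ k → Vec.sum (Vec.replicate k 0) ≡ 0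
    sum-replicate zero    = refl
    sum-replicate (suc k) = sum-replicate k
    monomialFrom-replicate : ∀ k i → monomialFrom i (Vec.replicate k 0) ≡ 1ℚ
    monomialFrom-replicate zero    i = refl
    monomialFrom-replicate (suc k) i = trans (ℚ.*-identityˡ _) (monomialFrom-replicate k (suc i))

  termSum-suc : ∀ L B w → suc w ≤ L → suc w ≤ B →
    termSum L B (suc w) ≡ ∑[ j < suc w ] (β (suc j) *ℚ termSum L B (w ∸ j))
  termSum-suc L B w w<L w<B = begin
    termSum L B (suc w)
      ≡⟨ ∑∈-cong (allVecs L B) (when-weight-term w) ⟩
    ∑[ t ∈ allVecs L B ] ∑ L (R t)
      ≡⟨ ∑∈-∑-comm (allVecs L B) L R ⟩
    ∑ L S
      ≡⟨ cong (λ n → ∑ n S) (sym (ℕ.m+[n∸m]≡n w<L)) ⟩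
    ∑ (suc w ℕ.+ (L ∸ suc w)) S
      ≡⟨ ∑-+ (suc w) (L ∸ suc w) S ⟩
    ∑ (suc w) S + ∑[ k < L ∸ suc w ] S (suc w ℕ.+ k)
      ≡⟨ cong₂ _+_ (∑-cong< (suc w) (λ j j≤w → ∑-removePart L B w j (ℕ.<-≤-trans j≤w w<L) (ℕ.≤-pred j≤w) w<B))
                   (∑-zero (L ∸ suc w) (λ k → ∑-removePart-vanish L B w (suc w ℕ.+ k) (ℕ.m≤m+n (suc w) k))) ⟩
    ∑[ j < suc w ] (β (suc j) *ℚ termSum L B (w ∸ j)) + 0ℚ
      ≡⟨ ℚ.+-identityʳ _ ⟩
    ∑[ j < suc w ] (β (suc j) *ℚ termSum L B (w ∸ j)) ∎
    where
    R : Vec ℕ L → ℕ → ℚ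
    R t j = when (weight t ≡ᵇ suc w) (removePart j t)
    S : ℕ → ℚ
    S j = ∑[ t ∈ allVecs L B ] R t j

  termSum-unique : (a : ℕ → ℚ) → a 0 ≡ 1ℚ →
    (∀ w → a (suc w) ≡ ∑[ j < suc w ] (β (suc j) *ℚ a (w ∸ j))) →
    ∀ L B w → w ≤ L → w ≤ B → termSum L B w ≡ a w
  termSum-unique a a₀ a-suc L B = ℕ.<-rec P step
    where
    P : ℕ → Set
    P w = w ≤ L → w ≤ B → termSum L B w ≡ a w
    step : ∀ w → (∀ {v} → v < w → P v) → P w
    step zero    _  _   _   = trans (termSum-zero L B) (sym a₀)
    step (suc w) ih w<L w<B = begin
      termSum L B (suc w)                                ≡⟨ termSum-suc L B w w<L w<B ⟩
      ∑[ j < suc w ] (β (suc j) *ℚ termSum L B (w ∸ j))  ≡⟨ ∑-cong (suc w) (λ j → cong (β (suc j) *ℚ_)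
                                                              (ih (s≤s (ℕ.m∸n≤m w j)) (below j w<L) (below j w<B))) ⟩
      ∑[ j < suc w ] (β (suc j) *ℚ a (w ∸ j))            ≡⟨ sym (a-suc w) ⟩
      a (suc w)                                          ∎
      where
      below : ∀ j {n} → suc w ≤ n → w ∸ j ≤ n
      below j w<n = ℕ.≤-trans (ℕ.m∸n≤m w j) (ℕ.≤-trans (ℕ.n≤1+n w) w<n)

-- Convolution inverses and Hessenberg determinants

_⋆_ : (ℕ → ℚ) → (ℕ → ℚ) → ℕ → ℚ
(b ⋆ f) N = ∑[ j < suc N ] (b j *ℚ f (N ∸ j))

⋆-suc : ∀ b f N → (b ⋆ f) (suc N) ≡ (b ⋆ (f ∘ suc)) N + b (suc N) *ℚ f 0
⋆-suc b f N = begin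
  ∑ (suc (suc N)) g            ≡⟨ ∑-suc (suc N) g ⟩
  ∑ (suc N) g + g (suc N)      ≡⟨ cong₂ _+_ (∑-cong< (suc N) (λ j j≤N → cong (λ n → b j *ℚ f n) (ℕ.+-∸-assoc 1 (ℕ.≤-pred j≤N))))
                                            (cong (λ n → b (suc N) *ℚ f n) (ℕ.n∸n≡0 N)) ⟩
  (b ⋆ (f ∘ suc)) N + b (suc N) *ℚ f 0 ∎
  where
  g : ℕ → ℚ
  g j = b j *ℚ f (suc N ∸ j)

hessenbergEntry : (ℕ → ℚ) → ℕ → ℕ → ℚ
hessenbergEntry c i j = if j ≤ᵇ i then c (i ∸ j ℕ.+ 1) else (if j ≡ᵇ suc i then 1ℚ else 0ℚ)

hessenbergEntry-suc : ∀ c i j → hessenbergEntry c (suc i) (suc j) ≡ hessenbergEntry c i j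
hessenbergEntry-suc c i zero    = refl
hessenbergEntry-suc c i (suc j) = refl

hessenberg : (ℕ → ℚ) → (n : ℕ) → Fin n → Fin n → ℚ
hessenberg c n i j = hessenbergEntry c (toℕ i) (toℕ j)

bordered : (ℕ → ℚ) → (ℕ → ℚ) → ∀ {n} → Fin n → Fin n → ℚ
bordered c f i Fin.zero    = f (toℕ i)
bordered c f i (Fin.suc j) = hessenbergEntry c (toℕ i) (suc (toℕ j))

minor : ∀ {n} → (Fin (suc n) → Fin (suc n) → ℚ) → Fin (suc n) → Fin n → Fin n → ℚ
minor M j r c = M (Fin.suc r) (punchIn j c)

det-cong : ∀ {n} {M N : Fin n → Fin n → ℚ} → (∀ i j → M i j ≡ N i j) → det M ≡ det N
det-cong {zero}  eq = refl
det-cong {suc n} eq = ∑∈-cong (allFin (suc n)) (λ j → cong (((- 1ℚ) ^ℚ toℕ j) *ℚ_)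
  (cong₂ _*ℚ_ (eq Fin.zero j) (det-cong (λ r c → eq (Fin.suc r) (punchIn j c)))))

det-firstRow₂ : ∀ {n} (M : Fin (suc (suc n)) → Fin (suc (suc n)) → ℚ) →
  (∀ j → M Fin.zero (Fin.suc (Fin.suc j)) ≡ 0ℚ) →
  det M ≡ M Fin.zero Fin.zero *ℚ det (minor M Fin.zero) - M Fin.zero (Fin.suc Fin.zero) *ℚ det (minor M (Fin.suc Fin.zero))
det-firstRow₂ {n} M row = begin
  g Fin.zero + (g (Fin.suc Fin.zero) + sumℚ (map g (tabulate (Fin.suc ∘ Fin.suc))))
    ≡⟨ cong (λ x → g Fin.zero + (g (Fin.suc Fin.zero) + x)) rest≡0 ⟩
  g Fin.zero + (g (Fin.suc Fin.zero) + 0ℚ)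
    ≡⟨ solve 4 (λ a p b q → con 1ℚ :* (a :* p) :+ ((con (- 1ℚ) :* con 1ℚ) :* (b :* q) :+ con 0ℚ) := a :* p :- b :* q)
             refl (M Fin.zero Fin.zero) (det (minor M Fin.zero))
             (M Fin.zero (Fin.suc Fin.zero)) (det (minor M (Fin.suc Fin.zero))) ⟩
  M Fin.zero Fin.zero *ℚ det (minor M Fin.zero) - M Fin.zero (Fin.suc Fin.zero) *ℚ det (minor M (Fin.suc Fin.zero)) ∎
  where
  g : Fin (suc (suc n)) → ℚ
  g j = ((- 1ℚ) ^ℚ toℕ j) *ℚ (M Fin.zero j *ℚ det (minor M j))
  rest≡0 : sumℚ (map g (tabulate (Fin.suc ∘ Fin.suc))) ≡ 0ℚ
  rest≡0 = trans (cong sumℚ (trans (List.map-tabulate (Fin.suc ∘ Fin.suc) g) (sym (List.map-tabulate {n = n} (λ j → j) (g ∘ Fin.suc ∘ Fin.suc)))))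
    (∑∈-zero (allFin n) g₂≡0)
    where
    g₂≡0 : ∀ j → g (Fin.suc (Fin.suc j)) ≡ 0ℚ
    g₂≡0 j = begin
      s *ℚ (M Fin.zero (Fin.suc (Fin.suc j)) *ℚ d)  ≡⟨ cong (λ x → s *ℚ (x *ℚ d)) (row j) ⟩
      s *ℚ (0ℚ *ℚ d)                                ≡⟨ cong (s *ℚ_) (ℚ.*-zeroˡ d) ⟩
      s *ℚ 0ℚ                                       ≡⟨ ℚ.*-zeroʳ s ⟩
      0ℚ                                            ∎
      where
      s = (- 1ℚ) ^ℚ suc (suc (toℕ j))
      d = det (minor M (Fin.suc (Fin.suc j)))

module InverseSeries (a b : ℕ → ℚ) (a₀ : a 0 ≡ 1ℚ) (b₀ : b 0 ≡ 1ℚ)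
                     (b⋆a-suc : ∀ N → (b ⋆ a) (suc N) ≡ 0ℚ) where

  a-suc : ∀ w → a (suc w) ≡ - ∑[ j < suc w ] (b (suc j) *ℚ a (w ∸ j))
  a-suc w = begin
    a (suc w)          ≡⟨ sym (ℚ.*-identityˡ (a (suc w))) ⟩
    1ℚ *ℚ a (suc w)    ≡⟨ cong (_*ℚ a (suc w)) (sym b₀) ⟩
    b 0 *ℚ a (suc w)   ≡⟨ inverseˡ-unique _ _ (b⋆a-suc w) ⟩
    - ∑[ j < suc w ] (b (suc j) *ℚ a (w ∸ j)) ∎

  b⋆a∘suc : ∀ n → (b ⋆ (a ∘ suc)) n ≡ - b (suc n)
  b⋆a∘suc n = begin
    (b ⋆ (a ∘ suc)) n      ≡⟨ inverseˡ-unique _ _ (trans (sym (⋆-suc b a n)) (b⋆a-suc n)) ⟩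
    - (b (suc n) *ℚ a 0)   ≡⟨ cong (λ x → - (b (suc n) *ℚ x)) a₀ ⟩
    - (b (suc n) *ℚ 1ℚ)    ≡⟨ cong -_ (ℚ.*-identityʳ (b (suc n))) ⟩
    - b (suc n)            ∎

  -- Expanding along the first row, which is (f 0, 1, 0, …, 0), gives the recursion
  -- det (bordered f) = f 0 · det (hessenberg n) − det (bordered (f ∘ suc)) in one size less.
  det-hessenberg : ∀ n → det (hessenberg a n) ≡ ((- 1ℚ) ^ℚ n) *ℚ b n
  det-bordered : ∀ n f → det (bordered a f {suc n}) ≡ ((- 1ℚ) ^ℚ n) *ℚ (b ⋆ f) n

  det-hessenberg zero    = sym (trans (ℚ.*-identityˡ (b 0)) b₀)
  det-hessenberg (suc n) = begin
    det (hessenberg a (suc n))              ≡⟨ det-cong first-column ⟩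
    det (bordered a (a ∘ suc) {suc n})      ≡⟨ det-bordered n (a ∘ suc) ⟩
    s *ℚ (b ⋆ (a ∘ suc)) n                  ≡⟨ cong (s *ℚ_) (b⋆a∘suc n) ⟩
    s *ℚ (- b (suc n))                      ≡⟨ solve 2 (λ s x → s :* (:- x) := (con (- 1ℚ) :* s) :* x) refl s (b (suc n)) ⟩
    ((- 1ℚ) ^ℚ suc n) *ℚ b (suc n)          ∎
    where
    s = (- 1ℚ) ^ℚ n
    first-column : ∀ i j → hessenberg a (suc n) i j ≡ bordered a (a ∘ suc) i j
    first-column i Fin.zero    = cong a (ℕ.+-comm (toℕ i) 1)
    first-column i (Fin.suc j) = refl
  det-bordered zero f =
    trans (solve 1 (λ x → con 1ℚ :* (x :* con 1ℚ) :+ con 0ℚ := con 1ℚ :* (con 1ℚ :* x :+ con 0ℚ)) refl (f 0))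
          (cong (λ y → 1ℚ *ℚ (y *ℚ f 0 + 0ℚ)) (sym b₀))
  det-bordered (suc n) f = begin
    det M
      ≡⟨ det-firstRow₂ M (λ j → refl) ⟩
    f 0 *ℚ det (minor M Fin.zero) - 1ℚ *ℚ det (minor M (Fin.suc Fin.zero))
      ≡⟨ cong₂ (λ x y → f 0 *ℚ x - 1ℚ *ℚ y)
               (trans (det-cong {suc n} (λ r c → hessenbergEntry-suc a (toℕ r) (toℕ c))) (det-hessenberg (suc n)))
               (trans (det-cong minor₁) (det-bordered n (f ∘ suc))) ⟩
    f 0 *ℚ (((- 1ℚ) *ℚ s) *ℚ b (suc n)) - 1ℚ *ℚ (s *ℚ (b ⋆ (f ∘ suc)) n)
      ≡⟨ solve 4 (λ f₀ s x y → f₀ :* ((con (- 1ℚ) :* s) :* x) :- con 1ℚ :* (s :* y) := (con (- 1ℚ) :* s) :* (y :+ x :* f₀))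
               refl (f 0) s (b (suc n)) ((b ⋆ (f ∘ suc)) n) ⟩
    ((- 1ℚ) ^ℚ suc n) *ℚ ((b ⋆ (f ∘ suc)) n + b (suc n) *ℚ f 0)
      ≡⟨ cong (((- 1ℚ) ^ℚ suc n) *ℚ_) (sym (⋆-suc b f n)) ⟩
    ((- 1ℚ) ^ℚ suc n) *ℚ (b ⋆ f) (suc n) ∎
    where
    M = bordered a f {suc (suc n)}
    s = (- 1ℚ) ^ℚ n
    minor₁ : ∀ r c → minor M (Fin.suc Fin.zero) r c ≡ bordered a (f ∘ suc) r c
    minor₁ r Fin.zero    = refl
    minor₁ r (Fin.suc c) = hessenbergEntry-suc a (toℕ r) (suc (toℕ c))

-- Complementary Euler numbers

sinhCoeff : ℕ → ℚ
sinhCoeff j = inv! (suc (2 * j))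

eulerCoeff : (ℕ → ℚ) → ℕ → ℚ
eulerCoeff E k = E (2 * k) *ℚ inv! (2 * k)

isEven-2* : ∀ j → isEven (2 * j) ≡ true
isEven-2* zero    = refl
isEven-2* (suc j) = subst (λ n → isEven n ≡ true) (sym (ℕ.*-suc 2 j)) (isEven-2* j)

isEven-suc-2* : ∀ j → isEven (suc (2 * j)) ≡ false
isEven-suc-2* zero    = refl
isEven-suc-2* (suc j) = subst (λ n → isEven (suc n) ≡ false) (sym (ℕ.*-suc 2 j)) (isEven-suc-2* j)

-- sinh t / t is even, so the identity (sinh t / t) (t / sinh t) = 1 only involves
-- the even coefficients of t / sinh t.
sinhCoeff⋆eulerCoeff : ∀ E → IsComplementaryEuler E →
  ∀ N → (sinhCoeff ⋆ eulerCoeff E) N ≡ (if 2 * N ≡ᵇ 0 then 1ℚ else 0ℚ)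
sinhCoeff⋆eulerCoeff E isE N = begin
  ∑[ j < suc N ] (sinhCoeff j *ℚ eulerCoeff E (N ∸ j))
    ≡⟨ sym (∑-cong (suc N) even) ⟩
  ∑[ j < suc N ] g (2 * j)
    ≡⟨ sym (∑-even N g odd) ⟩
  ∑ (suc (2 * N)) g
    ≡⟨ sym (∑∈-applyUpTo (suc (2 * N)) (λ k → k) g) ⟩
  sumℚ (map g (upTo (suc (2 * N))))
    ≡⟨ isE (2 * N) ⟩
  (if 2 * N ≡ᵇ 0 then 1ℚ else 0ℚ) ∎
  where
  g : ℕ → ℚ
  g k = sinhOverTCoeff k *ℚ (E (2 * N ∸ k) *ℚ inv! (2 * N ∸ k))
  odd : ∀ j → g (suc (2 * j)) ≡ 0ℚ
  odd j = trans (cong (λ c → (if c then inv! (suc (suc (2 * j))) else 0ℚ) *ℚ e) (isEven-suc-2* j))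
                (ℚ.*-zeroˡ e)
    where
    e = E (2 * N ∸ suc (2 * j)) *ℚ inv! (2 * N ∸ suc (2 * j))
  even : ∀ j → g (2 * j) ≡ sinhCoeff j *ℚ eulerCoeff E (N ∸ j)
  even j = cong₂ _*ℚ_ (cong (λ c → if c then inv! (suc (2 * j)) else 0ℚ) (isEven-2* j))
                      (cong (λ n → E n *ℚ inv! n) (sym (ℕ.*-distribˡ-∸ 2 N j)))

β : ℕ → ℚ
β i = (- 1ℚ) *ℚ inv! (2 * i ℕ.+ 1)

open MultinomialExpansion β

summand≡term : ∀ {k} (t : Vec ℕ k) → summand t ≡ term t
summand≡term t = trans (ℚ.*-assoc (ℕtoℚ (Vec.sum t !)) _ _) (cong (ℕtoℚ (Vec.sum t !) *ℚ_) (factors 1 t))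
  where
  factors : ∀ {k} i (t : Vec ℕ k) →
    prodℚ (Vec.toList (Vec.map inv! t)) *ℚ (((- 1ℚ) ^ℚ Vec.sum t) *ℚ powProdFrom i t) ≡ monomialFrom i t
  factors i []       = refl
  factors i (x ∷ ts) = begin
    (inv! x *ℚ p) *ℚ (((- 1ℚ) ^ℚ (x ℕ.+ Vec.sum ts)) *ℚ (c ^ℚ x *ℚ q))
      ≡⟨ cong (λ z → (inv! x *ℚ p) *ℚ (z *ℚ (c ^ℚ x *ℚ q))) (^ℚ-homo-+ (- 1ℚ) x (Vec.sum ts)) ⟩
    (inv! x *ℚ p) *ℚ ((((- 1ℚ) ^ℚ x) *ℚ ((- 1ℚ) ^ℚ Vec.sum ts)) *ℚ (c ^ℚ x *ℚ q))
      ≡⟨ solve 6 (λ i p s s′ cx q → (i :* p) :* ((s :* s′) :* (cx :* q)) := ((s :* cx) :* i) :* (p :* (s′ :* q)))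
               refl (inv! x) p ((- 1ℚ) ^ℚ x) ((- 1ℚ) ^ℚ Vec.sum ts) (c ^ℚ x) q ⟩
    ((((- 1ℚ) ^ℚ x) *ℚ (c ^ℚ x)) *ℚ inv! x) *ℚ (p *ℚ (((- 1ℚ) ^ℚ Vec.sum ts) *ℚ q))
      ≡⟨ cong₂ (λ u v → (u *ℚ inv! x) *ℚ v) (sym (^ℚ-distrib-* (- 1ℚ) c x)) (factors (suc i) ts) ⟩
    ((β i ^ℚ x) *ℚ inv! x) *ℚ monomialFrom (suc i) ts ∎
    where
    c = inv! (2 * i ℕ.+ 1)
    p = prodℚ (Vec.toList (Vec.map inv! ts))
    q = powProdFrom (suc i) ts

module _ (E : ℕ → ℚ) (isE : IsComplementaryEuler E) where

  eulerCoeff-zero : eulerCoeff E 0 ≡ 1ℚ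
  eulerCoeff-zero = trans (sym (trans (ℚ.+-identityʳ _) (ℚ.*-identityˡ _))) (sinhCoeff⋆eulerCoeff E isE 0)

  open InverseSeries (eulerCoeff E) sinhCoeff eulerCoeff-zero refl (sinhCoeff⋆eulerCoeff E isE ∘ suc)

  eulerCoeff-suc : ∀ w → eulerCoeff E (suc w) ≡ ∑[ j < suc w ] (β (suc j) *ℚ eulerCoeff E (w ∸ j))
  eulerCoeff-suc w = trans (a-suc w) (trans (sym (∑-neg (suc w) (λ j → sinhCoeff (suc j) *ℚ eulerCoeff E (w ∸ j)))) (∑-cong (suc w) negate))
    where
    negate : ∀ j → - (sinhCoeff (suc j) *ℚ eulerCoeff E (w ∸ j)) ≡ β (suc j) *ℚ eulerCoeff E (w ∸ j)
    negate j = trans (solve 2 (λ x y → :- (x :* y) := (con (- 1ℚ) :* x) :* y) refl (sinhCoeff (suc j)) _)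
                     (cong (λ n → ((- 1ℚ) *ℚ inv! n) *ℚ eulerCoeff E (w ∸ j)) (ℕ.+-comm 1 (2 * suc j)))

  E-multinomial : ∀ n → E (2 * n) ≡ ℕtoℚ ((2 * n) !) *ℚ sumℚ (map summand (tuples n))
  E-multinomial n = sym (begin
    ℕtoℚ ((2 * n) !) *ℚ sumℚ (map summand (tuples n))
      ≡⟨ cong (ℕtoℚ ((2 * n) !) *ℚ_) (trans (∑∈-filterᵇ _ (allVecs n n) summand)
              (∑∈-cong (allVecs n n) (λ t → cong (when (weight t ≡ᵇ n)) (summand≡term t)))) ⟩
    ℕtoℚ ((2 * n) !) *ℚ termSum n n n
      ≡⟨ cong (ℕtoℚ ((2 * n) !) *ℚ_) (termSum-unique (eulerCoeff E) eulerCoeff-zero eulerCoeff-suc n n n ℕ.≤-refl ℕ.≤-refl) ⟩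
    ℕtoℚ ((2 * n) !) *ℚ (E (2 * n) *ℚ inv! (2 * n))
      ≡⟨ solve 3 (λ f e i → f :* (e :* i) := e :* (f :* i)) refl (ℕtoℚ ((2 * n) !)) (E (2 * n)) (inv! (2 * n)) ⟩
    E (2 * n) *ℚ (ℕtoℚ ((2 * n) !) *ℚ inv! (2 * n))
      ≡⟨ cong (E (2 * n) *ℚ_) (!*inv!≡1 (2 * n)) ⟩
    E (2 * n) *ℚ 1ℚ
      ≡⟨ ℚ.*-identityʳ (E (2 * n)) ⟩
    E (2 * n) ∎)

  -- Mhat E n unfolds to hessenberg (eulerCoeff E) n.
  det-Mhat : ∀ n → det (Mhat E n) ≡ ((- 1ℚ) ^ℚ n) *ℚ sinhCoeff n
  det-Mhat = det-hessenberg

-- Both identities also hold for n = 0.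
corollary2 : (E : ℕ → ℚ) → IsComplementaryEuler E → (n : ℕ) → 1 ≤ n →
    (E (2 * n) ≡ ℕtoℚ ((2 * n) !) *ℚ sumℚ (map summand (tuples n)))
    × (((- 1ℚ) ^ℚ n) *ℚ inv! (suc (2 * n)) ≡ det (Mhat E n))
corollary2 E isE n _ = E-multinomial E isE n , sym (det-Mhat E isE n)
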